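{- Let $N=(S,A,T)$ be a P/T net with silent moves. For every pair of markings $m_1,m_2\in\mathcal{M}(S)$ it is decidable whether $m_1\approx_p m_2$; i.e., there is an algorithm that, given $N$, $m_1$ and $m_2$, decides whether there exists a branching place bisimulation $R\subseteq S\times S$ with $(m_1,m_2)\in R^\oplus$.
   Context: A P/T net is $N=(S,A,T)$ with $S$ a finite set of places, $A$ a finite set of labels, and $T\subseteq(\mathcal{M}(S)\setminus\{\theta\})\times A\times\mathcal{M}(S)$ a finite set of transitions, where $\mathcal{M}(S)$ is the set of finite multisets over $S$ (markings) and $\theta$ is the empty multiset. $N$ is a net with silent moves if $\tau\in A$ ($\tau$ is the invisible label). For $t=(m,\ell,m')$ write ${}^\bullet t=m$ (pre-set), $l(t)=\ell$, $t^\bullet=m'$ (post-set). $\oplus$ is multiset union, $\ominus$ truncated multiset difference, $\subseteq$ multiset inclusion, $|m|$ the size of $m$. A transition $t$ is enabled at $m$ if ${}^\bullet t\subseteq m$, and firing gives $m[t\rangle m'$ with $m'=(m\ominus{}^\bullet t)\oplus t^\bullet$; firing sequences $m[\sigma\rangle m'$ are defined inductively ($m[\epsilon\rangle m$; if $m[\sigma\rangle m'$ and $m'[t\rangle m''$ then $m[\sigma t\rangle m''$). For transition sequences: ${}^\bullet\epsilon=\theta$, ${}^\bullet(t\sigma)={}^\bullet t\oplus({}^\bullet\sigma\ominus t^\bullet)$, $\epsilon^\bullet=\theta$, $(t\sigma)^\bullet=\sigma^\bullet\oplus(t^\bullet\ominus{}^\bullet\sigma)$. A transition $t$ is $\tau$-sequential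 if $l(t)=\tau$ and $|{}^\bullet t|=|t^\bullet|=1$. For each $s\in S$ the fictitious idling transition is $i(s)=(s,\tau,s)$; $I(S)=\{i(s)\mid s\in S\}$, and idling transitions may be used in transition sequences (fired like ordinary transitions). A sequence $\sigma=t_1\dots t_n$ ($n\ge1$, $t_i\in T\cup I(S)$) is $\tau$-1-sequential if $l(t_i)=\tau$ and $|{}^\bullet t_i|=|t_i^\bullet|=1$ for all $i$ and $t_i^\bullet={}^\bullet t_{i+1}$ for $i<n$. A sequence $\sigma=\sigma_1\dots\sigma_k$ is $\tau$-$k$-sequential if each $\sigma_i$ is $\tau$-1-sequential, ${}^\bullet\sigma={}^\bullet\sigma_1\oplus\dots\oplus{}^\bullet\sigma_k$ and $\sigma^\bullet=\sigma_1^\bullet\oplus\dots\oplus\sigma_k^\bullet$; $\sigma$ is $\tau$-sequential if it is $\tau$-$k$-sequential for some $k\ge1$. For a place relation $R\subseteq S\times S$, its additive closure $R^\oplus\subseteq\mathcal{M}(S)\times\mathcal{M}(S)$ is the least relation such that $(\theta,\theta)\in R^\oplus$ and, if $(s_1,s_2)\in R$ and $(m_1,m_2)\in R^\oplus$, then $(s_1\oplus m_1,s_2\oplus m_2)\in R^\oplus$. For a $\tau$-sequential $\sigma=t_1\dots t_n$ with ${}^\bullet\sigma=m_0[t_1\rangle m_1[t_2\rangle\cdots m_{n-1}[t_n\rangle m_n=\sigma^\bullet$, the predicate $\Psi(m,\sigma,R^\oplus)$ holds iff $(m,m_i)\in R^\oplus$ for $i=0,\dots,n-1$, and $\Phi(\sigma,m,R^\oplus)$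 holds iff $(m_i,m)\in R^\oplus$ for $i=0,\dots,n-1$. A branching place bisimulation is $R\subseteq S\times S$ such that whenever $(m_1,m_2)\in R^\oplus$: (1) for every $t_1$ with $m_1[t_1\rangle m_1'$, either (i) $t_1$ is $\tau$-sequential and there are a $\tau$-sequential $\sigma$ and $m_2'$ with $m_2[\sigma\rangle m_2'$, $\Psi({}^\bullet t_1,\sigma,R^\oplus)$, $({}^\bullet t_1,\sigma^\bullet)\in R^\oplus$, $(t_1^\bullet,\sigma^\bullet)\in R^\oplus$ and $(m_1\ominus{}^\bullet t_1,m_2\ominus{}^\bullet\sigma)\in R^\oplus$; or (ii) there are a $\tau$-sequential $\sigma$, $t_2\in T$, $m$, $m_2'$ with $m_2[\sigma\rangle m[t_2\rangle m_2'$, $\sigma^\bullet={}^\bullet t_2$, $l(t_1)=l(t_2)$, $\Psi({}^\bullet t_1,\sigma,R^\oplus)$, $({}^\bullet t_1,\sigma^\bullet)\in R^\oplus$, $(t_1^\bullet,t_2^\bullet)\in R^\oplus$ and $(m_1\ominus{}^\bullet t_1,m_2\ominus{}^\bullet\sigma)\in R^\oplus$; (2) symmetrically, for every $t_2$ with $m_2[t_2\rangle m_2'$, either (i) $t_2$ is $\tau$-sequential and there are a $\tau$-sequential $\sigma$ and $m_1'$ with $m_1[\sigma\rangle m_1'$, $\Phi(\sigma,{}^\bullet t_2,R^\oplus)$, $(\sigma^\bullet,{}^\bullet t_2)\in R^\oplus$, $(\sigma^\bullet,t_2^\bullet)\in R^\oplus$ and $(m_1\ominus{}^\bullet\sigma,m_2\ominus{}^\bullet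 t_2)\in R^\oplus$; or (ii) there are a $\tau$-sequential $\sigma$, $t_1\in T$, $m$, $m_1'$ with $m_1[\sigma\rangle m[t_1\rangle m_1'$, $\sigma^\bullet={}^\bullet t_1$, $l(t_1)=l(t_2)$, $\Phi(\sigma,{}^\bullet t_2,R^\oplus)$, $(\sigma^\bullet,{}^\bullet t_2)\in R^\oplus$, $(t_1^\bullet,t_2^\bullet)\in R^\oplus$ and $(m_1\ominus{}^\bullet\sigma,m_2\ominus{}^\bullet t_2)\in R^\oplus$. Markings $m_1,m_2$ are branching place bisimilar, $m_1\approx_p m_2$, if some branching place bisimulation $R$ has $(m_1,m_2)\in R^\oplus$. -}

module Defs where

open import Data.Nat using (ℕ; zero; suc; _+_; _∸_; _≤_)
open import Data.Fin using (Fin; _≟_)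
open import Data.Vec using (Vec; zipWith; replicate; tabulate; lookup) renaming (sum to vsum)
open import Data.List using (List; []; _∷_; concat; map; foldr)
open import Data.List.Relation.Unary.All using (All)
open import Data.List.Membership.Propositional using (_∈_)
open import Data.Product using (Σ; _×_; ∃; _,_)
open import Data.Sum using (_⊎_)
open import Data.Unit using (⊤)
open import Data.Empty using (⊥)
open import Data.Bool using (Bool; true; if_then_else_)
open import Relation.Nullary using (¬_)
open import Relation.Nullary.Decidable using (⌊_⌋)
open import Relation.Binary.PropositionalEquality using (_≡_)

Marking : ℕ → Set
Marking n = Vec ℕ n

θ : ∀ {n} → Marking n
θ {n} = replicate n 0

_⊕_ : ∀ {n} → Marking n → Marking n → Marking n
_⊕_ = zipWith _+_

_⊖_ : ∀ {n} → Marking n → Marking n → Marking n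
_⊖_ = zipWith _∸_

_⊆_ : ∀ {n} → Marking n → Marking n → Set
m ⊆ m' = ∀ i → lookup m i ≤ lookup m' i

∣_∣ : ∀ {n} → Marking n → ℕ
∣ m ∣ = vsum m

⟦_⟧ : ∀ {n} → Fin n → Marking n
⟦ s ⟧ = tabulate (λ i → if ⌊ i ≟ s ⌋ then 1 else 0)

sumM : ∀ {n} → List (Marking n) → Marking n
sumM = foldr _⊕_ θ

Label : ℕ → Set
Label k = Fin (suc k)

τ : ∀ {k} → Label k
τ = Data.Fin.zero

record Transition (n k : ℕ) : Set where
  constructor tr
  field
    pre  : Marking n
    lab  : Label k
    post : Marking n
open Transition public

record Net : Set where
  field
    places : ℕ
    labels : ℕ
    trans  : List (Transition places labels)
    pre-nonempty : All (λ t → ¬ (pre t ≡ θ)) trans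
open Net public

module _ (N : Net) where
  private
    n = places N
    k = labels N
    Tr = Transition n k

  idle : Fin n → Tr
  idle s = tr ⟦ s ⟧ τ ⟦ s ⟧

  InTI : Tr → Set
  InTI t = t ∈ trans N ⊎ Σ (Fin n) (λ s → t ≡ idle s)

  Enabled : Tr → Marking n → Set
  Enabled t m = pre t ⊆ m

  fire : Marking n → Tr → Marking n
  fire m t = (m ⊖ pre t) ⊕ post t

  Fires : Marking n → Tr → Marking n → Set
  Fires m t m' = Enabled t m × m' ≡ fire m t

  data FireSeq : Marking n → List Tr → Marking n → Set where
    done : ∀ {m} → FireSeq m [] m
    step : ∀ {m m' m'' t σ} → InTI t → Fires m t m' → FireSeq m' σ m'' →
           FireSeq m (t ∷ σ) m''

  preS : List Tr → Marking n
  preS [] = θ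
  preS (t ∷ σ) = pre t ⊕ (preS σ ⊖ post t)

  postS : List Tr → Marking n
  postS [] = θ
  postS (t ∷ σ) = postS σ ⊕ (post t ⊖ preS σ)

  TauSeqT : Tr → Set
  TauSeqT t = lab t ≡ τ × ∣ pre t ∣ ≡ 1 × ∣ post t ∣ ≡ 1

  Chain : Tr → List Tr → Set
  Chain t [] = ⊤
  Chain t (u ∷ σ) = post t ≡ pre u × Chain u σ

  Tau1Seq : List Tr → Set
  Tau1Seq [] = ⊥
  Tau1Seq (t ∷ σ) = All InTI (t ∷ σ) × All TauSeqT (t ∷ σ) × Chain t σ

  TauSeq : List Tr → Set
  TauSeq σ = Σ (List (List Tr)) λ σs →
               ¬ (σs ≡ []) × concat σs ≡ σ × All Tau1Seq σs ×
               preS σ ≡ sumM (map preS σs) × postS σ ≡ sumM (map postS σs)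

  PlaceRel : Set
  PlaceRel = Fin n → Fin n → Bool

  data Add (R : PlaceRel) : Marking n → Marking n → Set where
    add-θ : Add R θ θ
    add-∷ : ∀ {s₁ s₂ m₁ m₂} → R s₁ s₂ ≡ true → Add R m₁ m₂ →
            Add R (⟦ s₁ ⟧ ⊕ m₁) (⟦ s₂ ⟧ ⊕ m₂)

  along : Marking n → List Tr → List (Marking n)
  along m [] = []
  along m (t ∷ σ) = m ∷ along (fire m t) σ

  Ψ : PlaceRel → Marking n → List Tr → Set
  Ψ R m σ = All (λ mᵢ → Add R m mᵢ) (along (preS σ) σ)

  Φ : PlaceRel → List Tr → Marking n → Set
  Φ R σ m = All (λ mᵢ → Add R mᵢ m) (along (preS σ) σ)

  Clause1 : PlaceRel → Marking n → Marking n → Set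
  Clause1 R m₁ m₂ = ∀ t₁ m₁' → t₁ ∈ trans N → Fires m₁ t₁ m₁' →
    (TauSeqT t₁ × Σ (List Tr) λ σ → Σ (Marking n) λ m₂' →
        TauSeq σ × FireSeq m₂ σ m₂' × Ψ R (pre t₁) σ ×
        Add R (pre t₁) (postS σ) × Add R (post t₁) (postS σ) ×
        Add R (m₁ ⊖ pre t₁) (m₂ ⊖ preS σ))
    ⊎
    (Σ (List Tr) λ σ → Σ Tr λ t₂ → Σ (Marking n) λ m → Σ (Marking n) λ m₂' →
        TauSeq σ × t₂ ∈ trans N × FireSeq m₂ σ m × Fires m t₂ m₂' ×
        postS σ ≡ pre t₂ × lab t₁ ≡ lab t₂ × Ψ R (pre t₁) σ ×
        Add R (pre t₁) (postS σ) × Add R (post t₁) (post t₂) ×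
        Add R (m₁ ⊖ pre t₁) (m₂ ⊖ preS σ))

  Clause2 : PlaceRel → Marking n → Marking n → Set
  Clause2 R m₁ m₂ = ∀ t₂ m₂' → t₂ ∈ trans N → Fires m₂ t₂ m₂' →
    (TauSeqT t₂ × Σ (List Tr) λ σ → Σ (Marking n) λ m₁' →
        TauSeq σ × FireSeq m₁ σ m₁' × Φ R σ (pre t₂) ×
        Add R (postS σ) (pre t₂) × Add R (postS σ) (post t₂) ×
        Add R (m₁ ⊖ preS σ) (m₂ ⊖ pre t₂))
    ⊎
    (Σ (List Tr) λ σ → Σ Tr λ t₁ → Σ (Marking n) λ m → Σ (Marking n) λ m₁' →
        TauSeq σ × t₁ ∈ trans N × FireSeq m₁ σ m × Fires m t₁ m₁' ×
        postS σ ≡ pre t₁ × lab t₁ ≡ lab t₂ × Φ R σ (pre t₂) ×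
        Add R (postS σ) (pre t₂) × Add R (post t₁) (post t₂) ×
        Add R (m₁ ⊖ preS σ) (m₂ ⊖ pre t₂))

  IsBranchingPlaceBisim : PlaceRel → Set
  IsBranchingPlaceBisim R = ∀ m₁ m₂ → Add R m₁ m₂ →
    Clause1 R m₁ m₂ × Clause2 R m₁ m₂

  BranchingPlaceBisimilar : Marking n → Marking n → Set
  BranchingPlaceBisimilar m₁ m₂ =
    Σ PlaceRel λ R → IsBranchingPlaceBisim R × Add R m₁ m₂

-- A place relation is a finite object, so it suffices to decide for a fixed R whether it is a branching
-- place bisimulation. Clause (2) for R is clause (1) for the converse relation. Since R⊕ is additive and
-- firing is monotone, clause (1) only has to be checked when m₁ is the pre-set of a transition t, and then
-- m₂ ranges over the finitely many markings R⊕-related to it. In a matching τ-sequential σ, the condition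
-- Ψ forces |•σ| = |•t|, so σ has |•t| τ-1-sequential components; erasing the loops of a component keeps
-- its pre-set, post-set and firability and only drops intermediate markings, and leaves it without
-- repetitions, hence of length at most |T ∪ I(S)|. Every quantifier therefore ranges over a finite list.

module Submission where

open import Defs
open import Data.Nat using (ℕ; zero; suc; _+_; _∸_; _≤_; z≤n; s≤s)
open import Data.Nat.Properties renaming (_≟_ to _≟ℕ_)
open import Data.Fin using (Fin; zero; suc; _≟_)
open import Data.Fin.Properties using (all?) renaming (any? to anyFin?)
open import Data.Vec using ([]; _∷_; lookup; tabulate) renaming (sum to vsum)
open import Data.Vec.Properties
  using (≡-dec; ∷-injectiveˡ; ∷-injectiveʳ; lookup-zipWith; lookup-replicate; lookup∘tabulate;
         tabulate-cong; tabulate-allFin; map-const;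
         zipWith-assoc; zipWith-comm; zipWith-identityˡ; zipWith-identityʳ; zipWith-zeroˡ)
open import Algebra.Properties.CommutativeSemigroup +-commutativeSemigroup
  using (interchange; xy∙z≈xz∙y)
open import Data.Bool using (Bool; true; false; if_then_else_)
open import Data.Bool.Properties using () renaming (_≟_ to _≟ᵇ_)
open import Data.Product using (Σ; _×_; _,_; proj₁; proj₂; ∃; uncurry)
open import Data.Sum using (_⊎_; inj₁; inj₂; [_,_]′)
open import Data.List using (List; []; _∷_; _++_; map; concat; length; cartesianProduct; allFin)
open import Data.List.Properties using (length-++-sucʳ; length-map; map-∘; map-cong-local)
open import Data.List.Relation.Unary.All as All using (All; []; _∷_)
open import Data.List.Relation.Unary.Any using (here; there; any?)
open import Data.List.Relation.Unary.All.Properties using (¬Any⇒All¬; map⁺)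
open import Data.List.Relation.Unary.Unique.Propositional using (Unique)
open import Data.List.Relation.Unary.AllPairs using ([]; _∷_)
import Data.List.Membership.DecPropositional as DecMembership
open import Data.List.Membership.Propositional using (_∈_; _∉_; find; lose)
open import Data.List.Membership.Propositional.Properties
  using (∈-map⁺; ∈-map⁻; ∈-++⁺ˡ; ∈-++⁺ʳ; ∈-++⁻; ∈-∃++; ∈-cartesianProduct⁺; ∈-allFin)
open import Data.Vec.Functional using (head; tail) renaming (_∷_ to _◂_)
open import Function using (_∘_; flip; _⇔_; mk⇔; Equivalence)
open import Relation.Unary using (Decidable)
open import Relation.Binary.Definitions using (_Respects_; DecidableEquality)
open import Relation.Nullary using (Dec; yes; no; ¬_; contradiction)
open import Relation.Nullary.Decidable using (⌊_⌋; map′; _×-dec_; _⊎-dec_; _→-dec_)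
open import Relation.Binary.PropositionalEquality
  using (_≡_; _≢_; refl; sym; cong; cong₂; subst; subst₂; module ≡-Reasoning)
  renaming (trans to ≡-trans)

private
  variable
    n : ℕ

⊕-assoc : (a b c : Marking n) → (a ⊕ b) ⊕ c ≡ a ⊕ (b ⊕ c)
⊕-assoc a b c = zipWith-assoc +-assoc a b c

⊕-comm : (a b : Marking n) → a ⊕ b ≡ b ⊕ a
⊕-comm a b = zipWith-comm +-comm a b

⊕-identityˡ : (a : Marking n) → θ ⊕ a ≡ a
⊕-identityˡ a = zipWith-identityˡ +-identityˡ a

⊕-identityʳ : (a : Marking n) → a ⊕ θ ≡ a
⊕-identityʳ a = zipWith-identityʳ +-identityʳ a

⊖-identityʳ : (a : Marking n) → a ⊖ θ ≡ a
⊖-identityʳ a = zipWith-identityʳ (λ _ → refl) a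

⊖-zeroˡ : (a : Marking n) → θ ⊖ a ≡ θ
⊖-zeroˡ = zipWith-zeroˡ 0∸n≡0

⊖-self : (a : Marking n) → a ⊖ a ≡ θ
⊖-self []      = refl
⊖-self (x ∷ a) = cong₂ _∷_ (n∸n≡0 x) (⊖-self a)

⊕-⊖-cancelʳ : (a b : Marking n) → (a ⊕ b) ⊖ b ≡ a
⊕-⊖-cancelʳ []      []      = refl
⊕-⊖-cancelʳ (x ∷ a) (y ∷ b) = cong₂ _∷_ (m+n∸n≡m x y) (⊕-⊖-cancelʳ a b)

⊕-⊖-cancelˡ : (c a b : Marking n) → (c ⊕ a) ⊖ (c ⊕ b) ≡ a ⊖ b
⊕-⊖-cancelˡ []      []      []      = refl
⊕-⊖-cancelˡ (z ∷ c) (x ∷ a) (y ∷ b) = cong₂ _∷_ ([m+n]∸[m+o]≡n∸o z x y) (⊕-⊖-cancelˡ c a b)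

-- In both identities the tokens p are taken from a first and only the rest, p ∸ a, from b ∸ c.
∸-distrib-+∸ : ∀ a b c p → (a + (b ∸ c)) ∸ p ≡ (a ∸ p) + (b ∸ (c + (p ∸ a)))
∸-distrib-+∸ a       b c zero    =
  cong (λ z → a + (b ∸ z)) (sym (≡-trans (cong (c +_) (0∸n≡0 a)) (+-identityʳ c)))
∸-distrib-+∸ zero    b c (suc p) = ∸-+-assoc b c (suc p)
∸-distrib-+∸ (suc a) b c (suc p) = ∸-distrib-+∸ a b c p

+∸-distrib-∸ : ∀ a b c p → (c ∸ b) + (p ∸ (a + (b ∸ c))) ≡ (c + (p ∸ a)) ∸ b
+∸-distrib-∸ a zero    c       p =
  cong (λ z → c + (p ∸ z)) (≡-trans (cong (a +_) (0∸n≡0 c)) (+-identityʳ a))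
+∸-distrib-∸ a (suc b) zero    p = sym (∸-+-assoc p a (suc b))
+∸-distrib-∸ a (suc b) (suc c) p = +∸-distrib-∸ a b c p

⊖-distrib-⊕⊖ : (a b c p : Marking n) → (a ⊕ (b ⊖ c)) ⊖ p ≡ (a ⊖ p) ⊕ (b ⊖ (c ⊕ (p ⊖ a)))
⊖-distrib-⊕⊖ []      []      []      []      = refl
⊖-distrib-⊕⊖ (x ∷ a) (y ∷ b) (z ∷ c) (w ∷ p) =
  cong₂ _∷_ (∸-distrib-+∸ x y z w) (⊖-distrib-⊕⊖ a b c p)

⊕⊖-distrib-⊖ : (a b c p : Marking n) → (c ⊖ b) ⊕ (p ⊖ (a ⊕ (b ⊖ c))) ≡ (c ⊕ (p ⊖ a)) ⊖ b
⊕⊖-distrib-⊖ []      []      []      []      = refl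
⊕⊖-distrib-⊖ (x ∷ a) (y ∷ b) (z ∷ c) (w ∷ p) =
  cong₂ _∷_ (+∸-distrib-∸ x y z w) (⊕⊖-distrib-⊖ a b c p)

lookup-⊕ : (a b : Marking n) (i : Fin n) → lookup (a ⊕ b) i ≡ lookup a i + lookup b i
lookup-⊕ a b i = lookup-zipWith _+_ i a b

lookup-⊖ : (a b : Marking n) (i : Fin n) → lookup (a ⊖ b) i ≡ lookup a i ∸ lookup b i
lookup-⊖ a b i = lookup-zipWith _∸_ i a b

lookup-θ : (i : Fin n) → lookup (θ {n}) i ≡ 0
lookup-θ i = lookup-replicate i 0

⊆-refl : {a : Marking n} → a ⊆ a
⊆-refl i = ≤-refl

⊆-trans : {a b c : Marking n} → a ⊆ b → b ⊆ c → a ⊆ c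
⊆-trans a⊆b b⊆c i = ≤-trans (a⊆b i) (b⊆c i)

θ⊆ : (a : Marking n) → θ ⊆ a
θ⊆ a i = subst (_≤ lookup a i) (sym (lookup-θ i)) z≤n

⊆θ⇒≡θ : {a : Marking n} → a ⊆ θ → a ≡ θ
⊆θ⇒≡θ {a = []}    _    = refl
⊆θ⇒≡θ {a = x ∷ a} a⊆θ = cong₂ _∷_ (n≤0⇒n≡0 (a⊆θ zero)) (⊆θ⇒≡θ (a⊆θ ∘ suc))

⊆-⊕ʳ : (a b : Marking n) → a ⊆ (a ⊕ b)
⊆-⊕ʳ a b i = subst (lookup a i ≤_) (sym (lookup-⊕ a b i)) (m≤m+n _ _)

⊆-⊕ˡ : (a b : Marking n) → b ⊆ (a ⊕ b)
⊆-⊕ˡ a b = subst (b ⊆_) (⊕-comm b a) (⊆-⊕ʳ b a)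

⊕-monoʳ-⊆ : (a : Marking n) {b c : Marking n} → b ⊆ c → (a ⊕ b) ⊆ (a ⊕ c)
⊕-monoʳ-⊆ a {b} {c} b⊆c i =
  subst₂ _≤_ (sym (lookup-⊕ a b i)) (sym (lookup-⊕ a c i)) (+-monoʳ-≤ (lookup a i) (b⊆c i))

⊖-⊆ : {p a m : Marking n} → p ⊆ (a ⊕ m) → (p ⊖ a) ⊆ m
⊖-⊆ {p = p} {a} {m} p⊆a⊕m i = subst₂ _≤_ (sym (lookup-⊖ p a i))
  (≡-trans (cong (_∸ lookup a i) (lookup-⊕ a m i)) (m+n∸m≡n (lookup a i) (lookup m i)))
  (∸-monoˡ-≤ (lookup a i) (p⊆a⊕m i))

⊕-⊖-assoc : (a : Marking n) {b c : Marking n} → c ⊆ b → (a ⊕ b) ⊖ c ≡ a ⊕ (b ⊖ c)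
⊕-⊖-assoc []      {[]}    {[]}    _   = refl
⊕-⊖-assoc (x ∷ a) {y ∷ b} {z ∷ c} c⊆b =
  cong₂ _∷_ (+-∸-assoc x (c⊆b zero)) (⊕-⊖-assoc a (λ i → c⊆b (suc i)))

⊕-⊖-inverse : {a b : Marking n} → a ⊆ b → a ⊕ (b ⊖ a) ≡ b
⊕-⊖-inverse {a = []}    {[]}    _   = refl
⊕-⊖-inverse {a = x ∷ a} {y ∷ b} a⊆b = cong₂ _∷_ (m+[n∸m]≡n (a⊆b zero)) (⊕-⊖-inverse (a⊆b ∘ suc))

⊖≡θ⇒≡ : {a b : Marking n} → a ⊖ b ≡ θ → b ⊆ a → a ≡ b
⊖≡θ⇒≡ {a = []}    {[]}    _     _   = refl
⊖≡θ⇒≡ {a = x ∷ a} {y ∷ b} a⊖b≡θ b⊆a =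
  cong₂ _∷_ (≤-antisym (m∸n≡0⇒m≤n (∷-injectiveˡ a⊖b≡θ)) (b⊆a zero))
            (⊖≡θ⇒≡ (∷-injectiveʳ a⊖b≡θ) (λ i → b⊆a (suc i)))

⊖⊕-⊕-comm : {m p : Marking n} (e q : Marking n) → p ⊆ m →
            ((m ⊕ e) ⊖ p) ⊕ q ≡ ((m ⊖ p) ⊕ q) ⊕ e
⊖⊕-⊕-comm {m = []}    {[]}    []      []      _   = refl
⊖⊕-⊕-comm {m = x ∷ m} {y ∷ p} (z ∷ e) (w ∷ q) p⊆m =
  cong₂ _∷_ (≡-trans (cong (_+ w) (+-∸-comm z (p⊆m zero))) (xy∙z≈xz∙y (x ∸ y) z w))
            (⊖⊕-⊕-comm e q (λ i → p⊆m (suc i)))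

⊕⊖-⊆ : (m p q s : Marking n) → p ⊆ m → s ⊆ ((m ⊖ p) ⊕ q) → (p ⊕ (s ⊖ q)) ⊆ m
⊕⊖-⊆ (x ∷ m) (y ∷ p) (z ∷ q) (w ∷ s) p⊆m s⊆ zero = begin
  y + (w ∸ z)       ≤⟨ +-monoʳ-≤ y (∸-monoˡ-≤ z (s⊆ zero)) ⟩
  y + (x ∸ y + z ∸ z) ≡⟨ cong (y +_) (m+n∸n≡m (x ∸ y) z) ⟩
  y + (x ∸ y)       ≡⟨ m+[n∸m]≡n (p⊆m zero) ⟩
  x                 ∎
  where open ≤-Reasoning
⊕⊖-⊆ (_ ∷ m) (_ ∷ p) (_ ∷ q) (_ ∷ s) p⊆m s⊆ (suc i) =
  ⊕⊖-⊆ m p q s (λ j → p⊆m (suc j)) (λ j → s⊆ (suc j)) i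

_⊆?_ : (a b : Marking n) → Dec (a ⊆ b)
a ⊆? b = all? (λ i → lookup a i ≤? lookup b i)

lookup-⟦⟧ : (s i : Fin n) → lookup ⟦ s ⟧ i ≡ (if ⌊ i ≟ s ⌋ then 1 else 0)
lookup-⟦⟧ s = lookup∘tabulate _

lookup-⟦⟧-≡ : (s : Fin n) → lookup ⟦ s ⟧ s ≡ 1
lookup-⟦⟧-≡ s with s ≟ s | lookup-⟦⟧ s s
... | yes _  | eq = eq
... | no s≢s | _  = contradiction refl s≢s

lookup-⟦⟧-≢ : {s i : Fin n} → i ≢ s → lookup ⟦ s ⟧ i ≡ 0
lookup-⟦⟧-≢ {s = s} {i} i≢s with i ≟ s | lookup-⟦⟧ s i
... | yes i≡s | _  = contradiction i≡s i≢s
... | no _    | eq = eq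

⟦⟧⊆ : {s : Fin n} {p : Marking n} → 1 ≤ lookup p s → ⟦ s ⟧ ⊆ p
⟦⟧⊆ {s = s} {p} 1≤ps i with i ≟ s
... | yes refl = subst (_≤ lookup p s) (sym (lookup-⟦⟧-≡ s)) 1≤ps
... | no i≢s   = subst (_≤ lookup p i) (sym (lookup-⟦⟧-≢ i≢s)) z≤n

⊆-⟦⟧⊕ : {s : Fin n} {p m : Marking n} → lookup p s ≡ 0 → p ⊆ (⟦ s ⟧ ⊕ m) → p ⊆ m
⊆-⟦⟧⊕ {s = s} {p} {m} ps≡0 p⊆ i with i ≟ s
... | yes refl = subst (_≤ lookup m s) (sym ps≡0) z≤n
... | no i≢s   = subst (lookup p i ≤_)
  (≡-trans (lookup-⊕ ⟦ s ⟧ m i) (cong (_+ lookup m i) (lookup-⟦⟧-≢ i≢s))) (p⊆ i)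

size-θ : ∣ θ {n} ∣ ≡ 0
size-θ {zero}  = refl
size-θ {suc n} = size-θ {n}

size-⊕ : (a b : Marking n) → ∣ a ⊕ b ∣ ≡ ∣ a ∣ + ∣ b ∣
size-⊕ []      []      = refl
size-⊕ (x ∷ a) (y ∷ b) = ≡-trans (cong (x + y +_) (size-⊕ a b)) (interchange x y ∣ a ∣ ∣ b ∣)

size-⟦⟧ : (s : Fin n) → ∣ ⟦ s ⟧ ∣ ≡ 1
size-⟦⟧ {suc n} zero    = cong suc (≡-trans (cong vsum ⟦zero⟧-tail) (size-θ {n}))
  where
  ⟦zero⟧-tail : tabulate {n = n} (λ _ → 0) ≡ θ
  ⟦zero⟧-tail = ≡-trans (tabulate-allFin _) (map-const _ 0)
size-⟦⟧ {suc n} (suc s) = ≡-trans (cong vsum (cong (0 ∷_) (tabulate-cong ⌊suc≟suc⌋))) (size-⟦⟧ s)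
  where
  ⌊suc≟suc⌋ : ∀ i → (if ⌊ suc i ≟ suc s ⌋ then 1 else 0) ≡ (if ⌊ i ≟ s ⌋ then 1 else 0)
  ⌊suc≟suc⌋ i with i ≟ s
  ... | yes _ = refl
  ... | no _  = refl

size≡0⇒≡θ : {a : Marking n} → ∣ a ∣ ≡ 0 → a ≡ θ
size≡0⇒≡θ {a = []}       _  = refl
size≡0⇒≡θ {a = zero ∷ a} eq = cong (0 ∷_) (size≡0⇒≡θ eq)

module _ {A : Set} where

  boundedLists : ℕ → List A → List (List A)
  boundedLists zero    E = [] ∷ []
  boundedLists (suc k) E = [] ∷ map (uncurry _∷_) (cartesianProduct E (boundedLists k E))

  ∈-boundedLists : ∀ k {E} {xs : List A} → length xs ≤ k → All (_∈ E) xs → xs ∈ boundedLists k E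
  ∈-boundedLists zero    {xs = []}     _         _            = here refl
  ∈-boundedLists (suc k) {xs = []}     _         _            = here refl
  ∈-boundedLists (suc k) {xs = x ∷ xs} (s≤s len) (x∈E ∷ xs∈E) =
    there (∈-map⁺ (uncurry _∷_) (∈-cartesianProduct⁺ x∈E (∈-boundedLists k len xs∈E)))

  Unique-length≤ : {xs : List A} (E : List A) → Unique xs → All (_∈ E) xs → length xs ≤ length E
  Unique-length≤ E [] [] = z≤n
  Unique-length≤ {x ∷ xs} E (x≢xs ∷ unique) (x∈E ∷ xs∈E) with ∈-∃++ x∈E
  ... | as , bs , refl = subst (suc (length xs) ≤_) (sym (length-++-sucʳ as x bs))
    (s≤s (Unique-length≤ (as ++ bs) unique (All.zipWith (uncurry remove) (x≢xs , xs∈E))))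
    where
    remove : ∀ {y} → x ≢ y → y ∈ as ++ x ∷ bs → y ∈ as ++ bs
    remove x≢y y∈ with ∈-++⁻ as y∈
    ... | inj₁ y∈as          = ∈-++⁺ˡ y∈as
    ... | inj₂ (here y≡x)    = contradiction (sym y≡x) x≢y
    ... | inj₂ (there y∈bs)  = ∈-++⁺ʳ as y∈bs

  module _ {P : A → Set} where

    ∃?-among : (E : List A) → (∀ {x} → P x → ∃ λ y → y ∈ E × P y) → Decidable P → Dec (∃ P)
    ∃?-among E complete P? = map′ (λ p → let x , _ , px = find p in x , px)
                                  (λ (x , px) → let y , y∈E , py = complete px in lose y∈E py)
                                  (any? P? E)

    ∀?-among : (E : List A) → (∀ {x} → P x → x ∈ E) → {Q : A → Set} → Decidable P → Decidable Q →
               Dec (∀ x → P x → Q x)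
    ∀?-among E complete P? Q? = map′ (λ all x px → All.lookup all (complete px) px)
                                     (λ f → All.tabulate (λ {x} _ → f x))
                                     (All.all? (λ x → P? x →-dec Q? x) E)

    ∃∈? : (E : List A) → Decidable P → Dec (∃ λ x → x ∈ E × P x)
    ∃∈? E P? = map′ find (λ (_ , x∈E , px) → lose x∈E px) (any? P? E)

module LoopErasure {A : Set} (_≟_ : DecidableEquality A) where

  open DecMembership _≟_ using (_∈?_)

  last : A → List A → A
  last x []       = x
  last x (y ∷ ys) = last y ys

  last-≡ : ∀ {x y} zs → x ∈ zs → last x zs ≡ last y zs
  last-≡ (z ∷ zs) _ = refl

  dropThroughLast : A → List A → List A
  dropThroughLast x []       = []
  dropThroughLast x (y ∷ ys) with x ∈? ys | x ≟ y
  ... | yes _ | _     = dropThroughLast x ys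
  ... | no _  | yes _ = ys
  ... | no _  | no _  = y ∷ ys

  dropThroughLast-⊆ : ∀ x ys {z} → z ∈ dropThroughLast x ys → z ∈ ys
  dropThroughLast-⊆ x (y ∷ ys) z∈ with x ∈? ys | x ≟ y
  ... | yes _ | _     = there (dropThroughLast-⊆ x ys z∈)
  ... | no _  | yes _ = there z∈
  ... | no _  | no _  = z∈

  ∉-dropThroughLast : ∀ x ys → x ∉ dropThroughLast x ys
  ∉-dropThroughLast x (y ∷ ys) x∈ with x ∈? ys | x ≟ y
  ... | yes _   | _      = ∉-dropThroughLast x ys x∈
  ... | no x∉ys | yes _  = x∉ys x∈
  ... | no x∉ys | no x≢y with x∈
  ...   | here x≡y   = x≢y x≡y
  ...   | there x∈ys = x∉ys x∈ys

  dropThroughLast-∉ : ∀ x ys → x ∉ ys → dropThroughLast x ys ≡ ys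
  dropThroughLast-∉ x []       _  = refl
  dropThroughLast-∉ x (y ∷ ys) x∉ with x ∈? ys | x ≟ y
  ... | yes x∈ys | _       = contradiction (there x∈ys) x∉
  ... | no _     | yes x≡y = contradiction (here x≡y) x∉
  ... | no _     | no _    = refl

  Unique-dropThroughLast : ∀ x {ys} → Unique ys → Unique (dropThroughLast x ys)
  Unique-dropThroughLast x {[]}     _          = []
  Unique-dropThroughLast x {y ∷ ys} u@(_ ∷ u′) with x ∈? ys | x ≟ y
  ... | yes _ | _     = Unique-dropThroughLast x u′
  ... | no _  | yes _ = u′
  ... | no _  | no _  = u

  last-dropThroughLast : ∀ x ys → last x (dropThroughLast x ys) ≡ last x ys
  last-dropThroughLast x []       = refl
  last-dropThroughLast x (y ∷ ys) with x ∈? ys | x ≟ y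
  ... | yes x∈ys | _        = ≡-trans (last-dropThroughLast x ys) (last-≡ ys x∈ys)
  ... | no _     | yes refl = refl
  ... | no _     | no _     = refl

  eraseLoops : List A → List A
  eraseLoops []       = []
  eraseLoops (x ∷ xs) = x ∷ dropThroughLast x (eraseLoops xs)

  eraseLoops-⊆ : ∀ xs {z} → z ∈ eraseLoops xs → z ∈ xs
  eraseLoops-⊆ (x ∷ xs) (here z≡x) = here z≡x
  eraseLoops-⊆ (x ∷ xs) (there z∈) = there (eraseLoops-⊆ xs (dropThroughLast-⊆ x (eraseLoops xs) z∈))

  Unique-eraseLoops : ∀ xs → Unique (eraseLoops xs)
  Unique-eraseLoops []       = []
  Unique-eraseLoops (x ∷ xs) =
    ¬Any⇒All¬ _ (∉-dropThroughLast x (eraseLoops xs)) ∷ Unique-dropThroughLast x (Unique-eraseLoops xs)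

  last-eraseLoops : ∀ w xs → last w (eraseLoops xs) ≡ last w xs
  last-eraseLoops w []       = refl
  last-eraseLoops w (x ∷ xs) = ≡-trans (last-dropThroughLast x (eraseLoops xs)) (last-eraseLoops x xs)

Searchable : (A : Set) → (A → A → Set) → Set₁
Searchable A _≈_ = {P : A → Set} → P Respects _≈_ → Decidable P → Dec (∃ P)

Bool-searchable : Searchable Bool _≡_
Bool-searchable _ P? = map′ [ (true ,_) , (false ,_) ]′ (λ { (true , p) → inj₁ p ; (false , p) → inj₂ p })
                            (P? true ⊎-dec P? false)

module _ {B : Set} {_≈_ : B → B → Set} (≈-refl : ∀ {b} → b ≈ b) (search : Searchable B _≈_) where

  →-searchable : ∀ n → Searchable (Fin n → B) (λ f g → ∀ i → f i ≈ g i)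
  →-searchable zero    resp P? = map′ (_ ,_) (λ (f , pf) → resp (λ ()) pf) (P? (λ ()))
  →-searchable (suc n) {P} resp P? =
    map′ (λ (b , f , p) → b ◂ f , p) (λ (f , pf) → head f , tail f , resp ◂-head-tail pf)
         (search resp-head (λ b → →-searchable n (resp ∘ ◂-cong) (P? ∘ (b ◂_))))
    where
    ◂-cong : ∀ {b} {f g : Fin n → B} → (∀ i → f i ≈ g i) → ∀ i → (b ◂ f) i ≈ (b ◂ g) i
    ◂-cong f≈g zero    = ≈-refl
    ◂-cong f≈g (suc i) = f≈g i
    ◂-head-tail : {f : Fin (suc n) → B} → ∀ i → f i ≈ (head f ◂ tail f) i
    ◂-head-tail zero    = ≈-refl
    ◂-head-tail (suc i) = ≈-refl
    resp-head : (λ b → ∃ λ f → P (b ◂ f)) Respects _≈_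
    resp-head a≈b (f , pf) = f , resp (λ { zero → a≈b ; (suc i) → ≈-refl }) pf

module _ (N : Net) where

  private
    Tr = Transition (places N) (labels N)
    Mk = Marking (places N)

  _≟ᵗ_ : (t u : Tr) → Dec (t ≡ u)
  tr a l b ≟ᵗ tr a′ l′ b′ =
    map′ (λ { (refl , refl , refl) → refl }) (λ { refl → refl , refl , refl })
         (≡-dec _≟ℕ_ a a′ ×-dec l ≟ l′ ×-dec ≡-dec _≟ℕ_ b b′)

  open DecMembership _≟ᵗ_ using (_∈?_)
  open LoopErasure _≟ᵗ_

  InTI? : Decidable (InTI N)
  InTI? t = t ∈? trans N ⊎-dec anyFin? (λ s → t ≟ᵗ idle N s)

  TauSeqT? : Decidable (TauSeqT N)
  TauSeqT? t = lab t ≟ τ ×-dec ∣ pre t ∣ ≟ℕ 1 ×-dec ∣ post t ∣ ≟ℕ 1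

  Fires? : (m : Mk) (t : Tr) → Dec (∃ (Fires N m t))
  Fires? m t = map′ (λ en → _ , en , refl) (λ (_ , en , _) → en) (pre t ⊆? m)

  fire* : Mk → List Tr → Mk
  fire* m []      = m
  fire* m (t ∷ σ) = fire* (fire N m t) σ

  FireSeq⇒fire* : ∀ {m σ m′} → FireSeq N m σ m′ → m′ ≡ fire* m σ
  FireSeq⇒fire* done                    = refl
  FireSeq⇒fire* (step _ (_ , refl) run) = FireSeq⇒fire* run

  FireSeq? : (m : Mk) (σ : List Tr) → Dec (∃ (FireSeq N m σ))
  FireSeq? m []      = yes (m , done)
  FireSeq? m (t ∷ σ) =
    map′ (λ (inT , en , m′ , run) → m′ , step inT (en , refl) run)
         (λ { (m′ , step inT (en , refl) run) → inT , en , m′ , run })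
         (InTI? t ×-dec pre t ⊆? m ×-dec FireSeq? (fire N m t) σ)

  FireSeq-++ : ∀ {m m′ m″ α β} → FireSeq N m α m′ → FireSeq N m′ β m″ →
               FireSeq N m (α ++ β) m″
  FireSeq-++ done             run′ = run′
  FireSeq-++ (step inT f run) run′ = step inT f (FireSeq-++ run run′)

  FireSeq-++⁻ : ∀ {m m″} α {β} → FireSeq N m (α ++ β) m″ →
                ∃ λ m′ → FireSeq N m α m′ × FireSeq N m′ β m″
  FireSeq-++⁻ []      run              = _ , done , run
  FireSeq-++⁻ (t ∷ α) (step inT f run) =
    let m′ , runα , runβ = FireSeq-++⁻ α run in m′ , step inT f runα , runβ

  Fires-⊕ : ∀ {m t m′} (e : Mk) → Fires N m t m′ → Fires N (m ⊕ e) t (m′ ⊕ e)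
  Fires-⊕ {m} {t} e (en , refl) =
    ⊆-trans {a = pre t} {m} {m ⊕ e} en (⊆-⊕ʳ m e) , sym (⊖⊕-⊕-comm e (post t) en)

  FireSeq-⊕ : ∀ {m σ m′} (e : Mk) → FireSeq N m σ m′ → FireSeq N (m ⊕ e) σ (m′ ⊕ e)
  FireSeq-⊕ e done             = done
  FireSeq-⊕ e (step {m} {t = t} inT f run) = step inT (Fires-⊕ {m} {t} e f) (FireSeq-⊕ e run)

  FireSeq⇒preS⊆ : ∀ {m σ m′} → FireSeq N m σ m′ → preS N σ ⊆ m
  FireSeq⇒preS⊆ {m} done                    = θ⊆ m
  FireSeq⇒preS⊆ {m} (step {t = t} {σ} _ (en , refl) run) =
    ⊕⊖-⊆ m (pre t) (post t) (preS N σ) en (FireSeq⇒preS⊆ run)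

  preS-++ : ∀ α β → preS N (α ++ β) ≡ preS N α ⊕ (preS N β ⊖ postS N α)
  preS-++ []      β = sym (≡-trans (⊕-identityˡ _) (⊖-identityʳ _))
  preS-++ (t ∷ α) β = begin
    pre t ⊕ (preS N (α ++ β) ⊖ post t)
      ≡⟨ cong (λ z → pre t ⊕ (z ⊖ post t)) (preS-++ α β) ⟩
    pre t ⊕ ((preS N α ⊕ (preS N β ⊖ postS N α)) ⊖ post t)
      ≡⟨ cong (pre t ⊕_) (⊖-distrib-⊕⊖ (preS N α) (preS N β) (postS N α) (post t)) ⟩
    pre t ⊕ ((preS N α ⊖ post t) ⊕ (preS N β ⊖ postS N (t ∷ α)))
      ≡⟨ sym (⊕-assoc (pre t) _ _) ⟩
    preS N (t ∷ α) ⊕ (preS N β ⊖ postS N (t ∷ α)) ∎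
    where open ≡-Reasoning

  postS-++ : ∀ α β → postS N (α ++ β) ≡ postS N β ⊕ (postS N α ⊖ preS N β)
  postS-++ []      β = sym (≡-trans (cong (postS N β ⊕_) (⊖-zeroˡ _)) (⊕-identityʳ _))
  postS-++ (t ∷ α) β = begin
    postS N (α ++ β) ⊕ (post t ⊖ preS N (α ++ β))
      ≡⟨ cong₂ (λ z w → z ⊕ (post t ⊖ w)) (postS-++ α β) (preS-++ α β) ⟩
    (postS N β ⊕ (postS N α ⊖ preS N β)) ⊕ (post t ⊖ (preS N α ⊕ (preS N β ⊖ postS N α)))
      ≡⟨ ⊕-assoc (postS N β) _ _ ⟩
    postS N β ⊕ ((postS N α ⊖ preS N β) ⊕ (post t ⊖ (preS N α ⊕ (preS N β ⊖ postS N α))))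
      ≡⟨ cong (postS N β ⊕_) (⊕⊖-distrib-⊖ (preS N α) (preS N β) (postS N α) (post t)) ⟩
    postS N β ⊕ (postS N (t ∷ α) ⊖ preS N β) ∎
    where open ≡-Reasoning

  fire-⊕pre : (d : Mk) (u : Tr) → fire N (d ⊕ pre u) u ≡ d ⊕ post u
  fire-⊕pre d u = cong (_⊕ post u) (⊕-⊖-cancelʳ d (pre u))

  preS-chain : ∀ t r → Chain N t r → preS N (t ∷ r) ≡ pre t
  preS-chain t []      _          = ≡-trans (cong (pre t ⊕_) (⊖-zeroˡ (post t))) (⊕-identityʳ (pre t))
  preS-chain t (u ∷ r) (t→u , ch) = begin
    pre t ⊕ (preS N (u ∷ r) ⊖ post t) ≡⟨ cong (λ z → pre t ⊕ (z ⊖ post t)) (preS-chain u r ch) ⟩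
    pre t ⊕ (pre u ⊖ post t)          ≡⟨ cong (λ z → pre t ⊕ (pre u ⊖ z)) t→u ⟩
    pre t ⊕ (pre u ⊖ pre u)           ≡⟨ cong (pre t ⊕_) (⊖-self (pre u)) ⟩
    pre t ⊕ θ                         ≡⟨ ⊕-identityʳ (pre t) ⟩
    pre t                             ∎
    where open ≡-Reasoning

  postS-chain : ∀ t r → Chain N t r → postS N (t ∷ r) ≡ post (last t r)
  postS-chain t []      _          = ≡-trans (⊕-identityˡ _) (⊖-identityʳ (post t))
  postS-chain t (u ∷ r) (t→u , ch) = begin
    postS N (u ∷ r) ⊕ (post t ⊖ preS N (u ∷ r))
      ≡⟨ cong₂ (λ z w → z ⊕ (post t ⊖ w)) (postS-chain u r ch) (preS-chain u r ch) ⟩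
    post (last u r) ⊕ (post t ⊖ pre u) ≡⟨ cong (λ z → post (last u r) ⊕ (z ⊖ pre u)) t→u ⟩
    post (last u r) ⊕ (pre u ⊖ pre u)  ≡⟨ cong (post (last u r) ⊕_) (⊖-self (pre u)) ⟩
    post (last u r) ⊕ θ                ≡⟨ ⊕-identityʳ _ ⟩
    post (last u r)                    ∎
    where open ≡-Reasoning

  fire*-chain : ∀ (d : Mk) t r → Chain N t r → fire* (d ⊕ post t) r ≡ d ⊕ post (last t r)
  fire*-chain d t []      _             = refl
  fire*-chain d t (u ∷ r) (refl , ch) = ≡-trans (cong (λ z → fire* z r) (fire-⊕pre d u)) (fire*-chain d u r ch)

  along-chain : ∀ (d : Mk) t r → Chain N t r → along N (d ⊕ post t) r ≡ map (λ u → d ⊕ pre u) r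
  along-chain d t []      _           = refl
  along-chain d t (u ∷ r) (refl , ch) =
    cong ((d ⊕ pre u) ∷_) (≡-trans (cong (λ z → along N z r) (fire-⊕pre d u)) (along-chain d u r ch))

  FireSeq-chain : ∀ (d : Mk) t r → All (InTI N) r → Chain N t r →
                  FireSeq N (d ⊕ post t) r (d ⊕ post (last t r))
  FireSeq-chain d t []      _           _           = done
  FireSeq-chain d t (u ∷ r) (inU ∷ inR) (refl , ch) =
    step inU (⊆-⊕ˡ d (pre u) , sym (fire-⊕pre d u)) (FireSeq-chain d u r inR ch)

  Chain-dropThroughLast∈ : ∀ w x ys → Chain N w ys → x ∈ ys → Chain N x (dropThroughLast x ys)
  Chain-dropThroughLast∈ w x (y ∷ ys) (_ , ch) x∈ with x ∈? ys | x ≟ᵗ y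
  ... | yes x∈ys | _        = Chain-dropThroughLast∈ y x ys ch x∈ys
  ... | no _     | yes refl = ch
  ... | no x∉ys  | no x≢y with x∈
  ...   | here x≡y   = contradiction x≡y x≢y
  ...   | there x∈ys = contradiction x∈ys x∉ys

  Chain-dropThroughLast : ∀ x ys → Chain N x ys → Chain N x (dropThroughLast x ys)
  Chain-dropThroughLast x ys ch with x ∈? ys
  ... | yes x∈ys = Chain-dropThroughLast∈ x x ys ch x∈ys
  ... | no x∉ys  = subst (Chain N x) (sym (dropThroughLast-∉ x ys x∉ys)) ch

  Chain-eraseLoops : ∀ w xs → Chain N w xs → Chain N w (eraseLoops xs)
  Chain-eraseLoops w []       _          = _
  Chain-eraseLoops w (x ∷ xs) (w→x , ch) =
    w→x , Chain-dropThroughLast x (eraseLoops xs) (Chain-eraseLoops x xs ch)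

  fire*-++ : ∀ m α β → fire* m (α ++ β) ≡ fire* (fire* m α) β
  fire*-++ m []      β = refl
  fire*-++ m (t ∷ α) β = fire*-++ (fire N m t) α β

  along-++ : ∀ m α β → along N m (α ++ β) ≡ along N m α ++ along N (fire* m α) β
  along-++ m []      β = refl
  along-++ m (t ∷ α) β = cong (m ∷_) (along-++ (fire N m t) α β)

  -- σ′ ≼ σ: σ′ can replace σ in a match, where Ψ and Φ only get fewer intermediate markings to check.
  record _≼_ (σ′ σ : List Tr) : Set where
    field
      preS-≡    : preS N σ′ ≡ preS N σ
      postS-≡   : postS N σ′ ≡ postS N σ
      fire*-≡   : ∀ m → fire* m σ′ ≡ fire* m σ
      along-⊆   : ∀ m {y} → y ∈ along N m σ′ → y ∈ along N m σ
      FireSeq-≼ : ∀ {m m′} → FireSeq N m σ m′ → FireSeq N m σ′ m′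
  open _≼_

  ≼-refl : ∀ {σ} → σ ≼ σ
  ≼-refl = record
    { preS-≡ = refl ; postS-≡ = refl ; fire*-≡ = λ _ → refl
    ; along-⊆ = λ _ y∈ → y∈ ; FireSeq-≼ = λ run → run
    }

  ++-≼ : ∀ {α′ α β′ β} → α′ ≼ α → β′ ≼ β → (α′ ++ β′) ≼ (α ++ β)
  ++-≼ {α′} {α} {β′} {β} α′≼α β′≼β = record
    { preS-≡    = ≡-trans (preS-++ α′ β′)
                    (≡-trans (cong₂ _⊕_ (preS-≡ α′≼α) (cong₂ _⊖_ (preS-≡ β′≼β) (postS-≡ α′≼α)))
                             (sym (preS-++ α β)))
    ; postS-≡   = ≡-trans (postS-++ α′ β′)
                    (≡-trans (cong₂ _⊕_ (postS-≡ β′≼β) (cong₂ _⊖_ (postS-≡ α′≼α) (preS-≡ β′≼β)))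
                             (sym (postS-++ α β)))
    ; fire*-≡   = λ m → begin
        fire* m (α′ ++ β′)       ≡⟨ fire*-++ m α′ β′ ⟩
        fire* (fire* m α′) β′    ≡⟨ cong (λ z → fire* z β′) (fire*-≡ α′≼α m) ⟩
        fire* (fire* m α) β′     ≡⟨ fire*-≡ β′≼β (fire* m α) ⟩
        fire* (fire* m α) β      ≡⟨ sym (fire*-++ m α β) ⟩
        fire* m (α ++ β)         ∎
    ; along-⊆   = along-++-⊆
    ; FireSeq-≼ = λ run → let _ , runα , runβ = FireSeq-++⁻ α run
                          in FireSeq-++ (FireSeq-≼ α′≼α runα) (FireSeq-≼ β′≼β runβ)
    }
    where
    open ≡-Reasoning
    along-++-⊆ : ∀ m {y} → y ∈ along N m (α′ ++ β′) → y ∈ along N m (α ++ β)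
    along-++-⊆ m y∈ rewrite along-++ m α′ β′ | along-++ m α β with ∈-++⁻ (along N m α′) y∈
    ... | inj₁ y∈α′ = ∈-++⁺ˡ (along-⊆ α′≼α m y∈α′)
    ... | inj₂ y∈β′ rewrite fire*-≡ α′≼α m =
      ∈-++⁺ʳ (along N m α) (along-⊆ β′≼β (fire* m α) y∈β′)

  Tau1Seq-eraseLoops : ∀ {c} → Tau1Seq N c → Tau1Seq N (eraseLoops c)
  Tau1Seq-eraseLoops {t ∷ r} (inT , τT , ch) =
    All.tabulate (All.lookup inT ∘ eraseLoops-⊆ (t ∷ r)) ,
    All.tabulate (All.lookup τT ∘ eraseLoops-⊆ (t ∷ r)) ,
    Chain-dropThroughLast t (eraseLoops r) (Chain-eraseLoops t r ch)

  eraseLoops-≼ : ∀ {c} → Tau1Seq N c → eraseLoops c ≼ c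
  eraseLoops-≼ {t ∷ r} (_ ∷ inR , _ , ch) = record
    { preS-≡    = ≡-trans (preS-chain t r′ ch′) (sym (preS-chain t r ch))
    ; postS-≡   = ≡-trans (postS-chain t r′ ch′) (≡-trans (cong post last≡) (sym (postS-chain t r ch)))
    ; fire*-≡   = λ m → fire*-≡′ (m ⊖ pre t)
    ; along-⊆   = λ { m (here y≡m) → here y≡m ; m (there y∈) → there (along-⊆′ (m ⊖ pre t) y∈) }
    ; FireSeq-≼ = λ { {m} (step inT (en , refl) run) → step inT (en , refl) (FireSeq-≼′ (m ⊖ pre t) run) }
    }
    where
    r′ = dropThroughLast t (eraseLoops r)
    ch′ : Chain N t r′
    ch′ = Chain-dropThroughLast t (eraseLoops r) (Chain-eraseLoops t r ch)
    last≡ : last t r′ ≡ last t r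
    last≡ = last-eraseLoops t (t ∷ r)
    r′⊆r : ∀ {u} → u ∈ r′ → u ∈ r
    r′⊆r = eraseLoops-⊆ r ∘ dropThroughLast-⊆ t (eraseLoops r)
    fire*-≡′ : ∀ d → fire* (d ⊕ post t) r′ ≡ fire* (d ⊕ post t) r
    fire*-≡′ d = ≡-trans (fire*-chain d t r′ ch′)
                         (≡-trans (cong (λ u → d ⊕ post u) last≡) (sym (fire*-chain d t r ch)))
    along-⊆′ : ∀ d {y} → y ∈ along N (d ⊕ post t) r′ → y ∈ along N (d ⊕ post t) r
    along-⊆′ d y∈ rewrite along-chain d t r′ ch′ | along-chain d t r ch
      with ∈-map⁻ (λ u → d ⊕ pre u) y∈
    ... | u , u∈r′ , refl = ∈-map⁺ (λ u → d ⊕ pre u) (r′⊆r u∈r′)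
    FireSeq-≼′ : ∀ d {m′} → FireSeq N (d ⊕ post t) r m′ → FireSeq N (d ⊕ post t) r′ m′
    FireSeq-≼′ d run = subst (FireSeq N (d ⊕ post t) r′)
      (≡-trans (sym (fire*-chain d t r′ ch′)) (≡-trans (fire*-≡′ d) (sym (FireSeq⇒fire* run))))
      (FireSeq-chain d t r′ (All.tabulate (All.lookup inR ∘ r′⊆r)) ch′)

  concat-eraseLoops-≼ : ∀ {σs} → All (Tau1Seq N) σs → concat (map eraseLoops σs) ≼ concat σs
  concat-eraseLoops-≼ []       = ≼-refl
  concat-eraseLoops-≼ (T ∷ Ts) = ++-≼ (eraseLoops-≼ T) (concat-eraseLoops-≼ Ts)

  IsTauDecomposition : List (List Tr) → Set
  IsTauDecomposition σs = ¬ σs ≡ [] × All (Tau1Seq N) σs ×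
    preS N (concat σs) ≡ sumM (map (preS N) σs) × postS N (concat σs) ≡ sumM (map (postS N) σs)

  IsTauDecomposition? : Decidable IsTauDecomposition
  IsTauDecomposition? σs = nonEmpty? σs ×-dec All.all? Tau1Seq? σs ×-dec
                           ≡-dec _≟ℕ_ _ _ ×-dec ≡-dec _≟ℕ_ _ _
    where
    nonEmpty? : (xs : List (List Tr)) → Dec (¬ xs ≡ [])
    nonEmpty? []      = no (λ ne → ne refl)
    nonEmpty? (_ ∷ _) = yes (λ ())
    Chain? : ∀ t r → Dec (Chain N t r)
    Chain? t []      = yes _
    Chain? t (u ∷ r) = ≡-dec _≟ℕ_ (post t) (pre u) ×-dec Chain? u r
    Tau1Seq? : Decidable (Tau1Seq N)
    Tau1Seq? []      = no (λ ())
    Tau1Seq? (t ∷ r) = All.all? InTI? (t ∷ r) ×-dec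
      All.all? TauSeqT? (t ∷ r) ×-dec Chain? t r

  IsTauDecomposition-eraseLoops : ∀ {σs} → IsTauDecomposition σs → IsTauDecomposition (map eraseLoops σs)
  IsTauDecomposition-eraseLoops {σs} (ne , Ts , preS≡ , postS≡) =
    ne′ ne , map⁺ (All.map Tau1Seq-eraseLoops Ts) ,
    ≡-trans (preS-≡ ≼σ) (≡-trans preS≡ (cong sumM (sym (map-eraseLoops-≡ preS-≡)))) ,
    ≡-trans (postS-≡ ≼σ) (≡-trans postS≡ (cong sumM (sym (map-eraseLoops-≡ postS-≡))))
    where
    ≼σ = concat-eraseLoops-≼ Ts
    ne′ : ∀ {xs} → ¬ xs ≡ [] → ¬ map eraseLoops xs ≡ []
    ne′ {[]}    ne = ne
    ne′ {_ ∷ _} _  = λ ()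
    map-eraseLoops-≡ : {f : List Tr → Mk} → (∀ {c c′} → c′ ≼ c → f c′ ≡ f c) →
                       map f (map eraseLoops σs) ≡ map f σs
    map-eraseLoops-≡ f-≼ =
      ≡-trans (sym (map-∘ σs)) (map-cong-local (All.map (f-≼ ∘ eraseLoops-≼) Ts))

  transitionsTI : List Tr
  transitionsTI = trans N ++ map (idle N) (allFin (places N))

  InTI⇒∈ : ∀ {t} → InTI N t → t ∈ transitionsTI
  InTI⇒∈ (inj₁ t∈T)        = ∈-++⁺ˡ t∈T
  InTI⇒∈ (inj₂ (s , refl)) = ∈-++⁺ʳ (trans N) (∈-map⁺ (idle N) (∈-allFin s))

  τ-candidates : ℕ → List (List (List Tr))
  τ-candidates K = boundedLists K (boundedLists (length transitionsTI) transitionsTI)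

  size-sumM-preS : ∀ {σs} → All (Tau1Seq N) σs → ∣ sumM (map (preS N) σs) ∣ ≡ length σs
  size-sumM-preS []                                            = size-θ {places N}
  size-sumM-preS {(t ∷ r) ∷ σs} ((_ , (_ , ∣pre∣≡1 , _) ∷ _ , ch) ∷ Ts) = begin
    ∣ preS N (t ∷ r) ⊕ sumM (map (preS N) σs) ∣
      ≡⟨ size-⊕ (preS N (t ∷ r)) _ ⟩
    ∣ preS N (t ∷ r) ∣ + ∣ sumM (map (preS N) σs) ∣
      ≡⟨ cong₂ _+_ (≡-trans (cong ∣_∣ (preS-chain t r ch)) ∣pre∣≡1) (size-sumM-preS Ts) ⟩
    suc (length σs) ∎
    where open ≡-Reasoning

  eraseLoops-∈-τ-candidates : ∀ {σs} K → All (Tau1Seq N) σs → length σs ≤ K →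
                              map eraseLoops σs ∈ τ-candidates K
  eraseLoops-∈-τ-candidates {σs} K Ts len =
    ∈-boundedLists K (≤-trans (≤-reflexive (length-map eraseLoops σs)) len) (map⁺ (All.map short Ts))
    where
    short : ∀ {c} → Tau1Seq N c → eraseLoops c ∈ boundedLists (length transitionsTI) transitionsTI
    short {t ∷ r} T =
      ∈-boundedLists _ (Unique-length≤ transitionsTI (Unique-eraseLoops (t ∷ r)) c′⊆TI) c′⊆TI
      where
      c′⊆TI = All.map InTI⇒∈ (proj₁ (Tau1Seq-eraseLoops T))

  FireSeqWith? : ∀ m σ {Z : Mk → Set} → Decidable Z → Dec (∃ λ m′ → FireSeq N m σ m′ × Z m′)
  FireSeqWith? m σ {Z} Z? with FireSeq? m σ
  ... | no ¬run        = no (λ (m′ , run , _) → ¬run (m′ , run))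
  ... | yes (m′ , run) = map′ (λ z → m′ , run , z)
    (λ (m″ , run′ , z) → subst Z (≡-trans (FireSeq⇒fire* run′) (sym (FireSeq⇒fire* run))) z) (Z? m′)

  head-along : ∀ {P : Mk → Set} {σ} → TauSeq N σ → All P (along N (preS N σ) σ) → P (preS N σ)
  head-along ([] , ne , _)                           _       = contradiction refl ne
  head-along (([] ∷ _) , _ , _ , (() ∷ _) , _)       _
  head-along (((_ ∷ _) ∷ _) , _ , refl , _ , _)      (p ∷ _) = p

  TauRun : Mk → (Mk → Set) → (Mk → Mk → Mk → Set) → Set
  TauRun M P W = ∃ λ σ → TauSeq N σ ×
    ∃ λ m → FireSeq N M σ m × All P (along N (preS N σ) σ) × W (preS N σ) (postS N σ) m

  -- Complete because a witness shortened by loop erasure lies in τ-candidates K: its components are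
  -- repetition-free and there are |•σ| ≤ K of them.
  TauRun? : ∀ M {P W} K → (∀ {x} → P x → ∣ x ∣ ≤ K) →
            Decidable P → (∀ a b m → Dec (W a b m)) → Dec (TauRun M P W)
  TauRun? M {P} {W} K bound P? W? =
    map′ (λ (σs , D , rest) → concat σs , TauSeq-of D , rest)
         (λ { (σ , (σs , ne , refl , Ts , pe , qe) , rest) → σs , (ne , Ts , pe , qe) , rest })
         (∃?-among (τ-candidates K) shorten Q?)
    where
    TauSeq-of : ∀ {σs} → IsTauDecomposition σs → TauSeq N (concat σs)
    TauSeq-of {σs} (ne , Ts , pe , qe) = σs , ne , refl , Ts , pe , qe
    Q : List (List Tr) → Set
    Q σs = IsTauDecomposition σs × ∃ λ m → FireSeq N M (concat σs) m ×
           All P (along N (preS N (concat σs)) (concat σs)) × W (preS N (concat σs)) (postS N (concat σs)) m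
    Q? : Decidable Q
    Q? σs = IsTauDecomposition? σs ×-dec
            FireSeqWith? M (concat σs) (λ m → All.all? P? _ ×-dec W? _ _ m)
    shorten : ∀ {σs} → Q σs → ∃ λ σs′ → σs′ ∈ τ-candidates K × Q σs′
    shorten {σs} (D@(ne , Ts , pe , qe) , m , run , allP , w) =
      map eraseLoops σs , eraseLoops-∈-τ-candidates K Ts len ,
      IsTauDecomposition-eraseLoops D , m , FireSeq-≼ ≼σ run ,
      subst (λ a → All P (along N a σ′)) (sym (preS-≡ ≼σ))
            (All.tabulate (All.lookup allP ∘ along-⊆ ≼σ (preS N (concat σs)))) ,
      subst₂ (λ a b → W a b m) (sym (preS-≡ ≼σ)) (sym (postS-≡ ≼σ)) w
      where
      σ′ = concat (map eraseLoops σs)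
      ≼σ = concat-eraseLoops-≼ Ts
      len : length σs ≤ K
      len = subst (_≤ K) (≡-trans (cong ∣_∣ pe) (size-sumM-preS Ts))
                  (bound (head-along (TauSeq-of D) allP))

  size-Add : ∀ {R a b} → Add N R a b → ∣ a ∣ ≡ ∣ b ∣
  size-Add add-θ                                = refl
  size-Add (add-∷ {s₁} {s₂} {m₁} {m₂} _ rel) = begin
    ∣ ⟦ s₁ ⟧ ⊕ m₁ ∣     ≡⟨ size-⊕ ⟦ s₁ ⟧ m₁ ⟩
    ∣ ⟦ s₁ ⟧ ∣ + ∣ m₁ ∣ ≡⟨ cong₂ _+_ (≡-trans (size-⟦⟧ s₁) (sym (size-⟦⟧ s₂))) (size-Add rel) ⟩
    ∣ ⟦ s₂ ⟧ ∣ + ∣ m₂ ∣ ≡⟨ sym (size-⊕ ⟦ s₂ ⟧ m₂) ⟩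
    ∣ ⟦ s₂ ⟧ ⊕ m₂ ∣     ∎
    where open ≡-Reasoning

  Add-θˡ : ∀ {R b} → Add N R θ b → b ≡ θ
  Add-θˡ rel = size≡0⇒≡θ (≡-trans (sym (size-Add rel)) (size-θ {places N}))

  Add-flip : ∀ {R a b} → Add N R a b → Add N (flip R) b a
  Add-flip add-θ         = add-θ
  Add-flip (add-∷ r rel) = add-∷ r (Add-flip rel)

  Add-resp : ∀ {R R′} → (∀ i j → R i j ≡ R′ i j) → ∀ {a b} → Add N R a b → Add N R′ a b
  Add-resp R≗R′ add-θ                     = add-θ
  Add-resp R≗R′ (add-∷ {s₁} {s₂} r rel) =
    add-∷ (≡-trans (sym (R≗R′ s₁ s₂)) r) (Add-resp R≗R′ rel)

  -- A pair (s₁ , s₂) of the decomposition stays in the residue if s₁ ∉ p and is split off otherwise.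
  Add-split : ∀ {R m₁ m₂} → Add N R m₁ m₂ → ∀ p → p ⊆ m₁ →
              ∃ λ q → q ⊆ m₂ × Add N R p q × Add N R (m₁ ⊖ p) (m₂ ⊖ q)
  Add-split {R} add-θ p p⊆θ with ⊆θ⇒≡θ {a = p} p⊆θ
  ... | refl = θ , ⊆-refl {a = θ} , add-θ , subst₂ (Add N R) (sym (⊖-self θ)) (sym (⊖-self θ)) add-θ
  Add-split {R} (add-∷ {s₁} {s₂} {m₁} {m₂} r rel) p p⊆ with lookup p s₁ in ps₁
  ... | zero =
    let q , q⊆m₂ , rel-p , rel-rest = Add-split rel p p⊆m₁
    in q , ⊆-trans {a = q} {m₂} {⟦ s₂ ⟧ ⊕ m₂} q⊆m₂ (⊆-⊕ˡ ⟦ s₂ ⟧ m₂) , rel-p ,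
       subst₂ (Add N R) (sym (⊕-⊖-assoc ⟦ s₁ ⟧ p⊆m₁)) (sym (⊕-⊖-assoc ⟦ s₂ ⟧ q⊆m₂)) (add-∷ r rel-rest)
    where
    p⊆m₁ = ⊆-⟦⟧⊕ {s = s₁} {p} {m₁} ps₁ p⊆
  ... | suc _ =
    let q , q⊆m₂ , rel-p , rel-rest = Add-split rel (p ⊖ ⟦ s₁ ⟧) (⊖-⊆ {p = p} {⟦ s₁ ⟧} {m₁} p⊆)
    in ⟦ s₂ ⟧ ⊕ q , ⊕-monoʳ-⊆ ⟦ s₂ ⟧ q⊆m₂ ,
       subst (λ z → Add N R z (⟦ s₂ ⟧ ⊕ q)) s₁⊕p≡p (add-∷ r rel-p) ,
       subst₂ (Add N R) residue (sym (⊕-⊖-cancelˡ ⟦ s₂ ⟧ m₂ q)) rel-rest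
    where
    s₁⊕p≡p : ⟦ s₁ ⟧ ⊕ (p ⊖ ⟦ s₁ ⟧) ≡ p
    s₁⊕p≡p = ⊕-⊖-inverse (⟦⟧⊆ {s = s₁} {p} (subst (1 ≤_) (sym ps₁) (s≤s z≤n)))
    residue : m₁ ⊖ (p ⊖ ⟦ s₁ ⟧) ≡ (⟦ s₁ ⟧ ⊕ m₁) ⊖ p
    residue = ≡-trans (sym (⊕-⊖-cancelˡ ⟦ s₁ ⟧ m₁ (p ⊖ ⟦ s₁ ⟧))) (cong ((⟦ s₁ ⟧ ⊕ m₁) ⊖_) s₁⊕p≡p)

  private
    Pair = Fin (places N) × Fin (places N)

  lhs rhs : List Pair → Mk
  lhs = sumM ∘ map (⟦_⟧ ∘ proj₁)
  rhs = sumM ∘ map (⟦_⟧ ∘ proj₂)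

  RelatedPairs : PlaceRel N → List Pair → Set
  RelatedPairs R = All (λ (s₁ , s₂) → R s₁ s₂ ≡ true)

  Add⇒pairs : ∀ {R a b} → Add N R a b → ∃ λ ps → RelatedPairs R ps × a ≡ lhs ps × b ≡ rhs ps
  Add⇒pairs add-θ = [] , [] , refl , refl
  Add⇒pairs (add-∷ {s₁} {s₂} r rel) with Add⇒pairs rel
  ... | ps , related , refl , refl = (s₁ , s₂) ∷ ps , r ∷ related , refl , refl

  pairs⇒Add : ∀ {R} ps → RelatedPairs R ps → Add N R (lhs ps) (rhs ps)
  pairs⇒Add []       []            = add-θ
  pairs⇒Add (_ ∷ ps) (r ∷ related) = add-∷ r (pairs⇒Add ps related)

  pairLists : Mk → List (List Pair)
  pairLists a = boundedLists ∣ a ∣ (cartesianProduct (allFin _) (allFin _))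

  ∈-pairLists : ∀ ps → ps ∈ pairLists (lhs ps)
  ∈-pairLists ps = ∈-boundedLists _ (≤-reflexive (sym (size-lhs ps)))
    (All.tabulate (λ {(s₁ , s₂)} _ → ∈-cartesianProduct⁺ (∈-allFin s₁) (∈-allFin s₂)))
    where
    size-lhs : ∀ ps → ∣ lhs ps ∣ ≡ length ps
    size-lhs []       = size-θ {places N}
    size-lhs (p ∷ ps) =
      ≡-trans (size-⊕ ⟦ proj₁ p ⟧ (lhs ps)) (cong₂ _+_ (size-⟦⟧ (proj₁ p)) (size-lhs ps))

  Add? : ∀ R a b → Dec (Add N R a b)
  Add? R a b = map′ (λ { (ps , related , refl , refl) → pairs⇒Add ps related }) Add⇒pairs
    (∃?-among (pairLists a)
              (λ { {ps} (related , refl , b≡) → ps , ∈-pairLists ps , related , refl , b≡ })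
              (λ ps → All.all? (λ (s₁ , s₂) → R s₁ s₂ ≟ᵇ true) ps ×-dec
                      ≡-dec _≟ℕ_ a (lhs ps) ×-dec ≡-dec _≟ℕ_ b (rhs ps)))

  Add⇒∈map-rhs : ∀ {R a b} → Add N R a b → b ∈ map rhs (pairLists a)
  Add⇒∈map-rhs rel with Add⇒pairs rel
  ... | ps , _ , refl , refl = ∈-map⁺ rhs (∈-pairLists ps)

  -- Clause1 N R m₁ m₂ unfolds to  ∀ t₁ m₁′ → t₁ ∈ trans N → Fires N m₁ t₁ m₁′ → CanMatch R t₁ m₁ m₂.
  CanMatch : PlaceRel N → Tr → Mk → Mk → Set
  CanMatch R t₁ m₁ m₂ =
    (TauSeqT N t₁ × Σ (List Tr) λ σ → Σ Mk λ m₂′ →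
        TauSeq N σ × FireSeq N m₂ σ m₂′ × Ψ N R (pre t₁) σ ×
        Add N R (pre t₁) (postS N σ) × Add N R (post t₁) (postS N σ) ×
        Add N R (m₁ ⊖ pre t₁) (m₂ ⊖ preS N σ))
    ⊎
    (Σ (List Tr) λ σ → Σ Tr λ t₂ → Σ Mk λ m → Σ Mk λ m₂′ →
        TauSeq N σ × t₂ ∈ trans N × FireSeq N m₂ σ m × Fires N m t₂ m₂′ ×
        postS N σ ≡ pre t₂ × lab t₁ ≡ lab t₂ × Ψ N R (pre t₁) σ ×
        Add N R (pre t₁) (postS N σ) × Add N R (post t₁) (post t₂) ×
        Add N R (m₁ ⊖ pre t₁) (m₂ ⊖ preS N σ))

  Simulation : PlaceRel N → Set
  Simulation R = ∀ m₁ m₂ → Add N R m₁ m₂ → Clause1 N R m₁ m₂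

  Clause2⇒Clause1-flip : ∀ {R m₁ m₂} → Clause2 N R m₁ m₂ → Clause1 N (flip R) m₂ m₁
  Clause2⇒Clause1-flip c₂ t₂ m₂′ t₂∈T f with c₂ t₂ m₂′ t₂∈T f
  ... | inj₁ (τt , σ , m₁′ , T , run , φ , r₁ , r₂ , r₃) =
    inj₁ (τt , σ , m₁′ , T , run , All.map Add-flip φ , Add-flip r₁ , Add-flip r₂ , Add-flip r₃)
  ... | inj₂ (σ , t₁ , m , m₁′ , T , t₁∈T , run , f₁ , σ→t₁ , ℓ≡ , φ , r₁ , r₂ , r₃) =
    inj₂ (σ , t₁ , m , m₁′ , T , t₁∈T , run , f₁ , σ→t₁ , sym ℓ≡ , All.map Add-flip φ ,
          Add-flip r₁ , Add-flip r₂ , Add-flip r₃)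

  Clause1-flip⇒Clause2 : ∀ {R m₁ m₂} → Clause1 N (flip R) m₂ m₁ → Clause2 N R m₁ m₂
  Clause1-flip⇒Clause2 c₁ t₂ m₂′ t₂∈T f with c₁ t₂ m₂′ t₂∈T f
  ... | inj₁ (τt , σ , m₁′ , T , run , ψ , r₁ , r₂ , r₃) =
    inj₁ (τt , σ , m₁′ , T , run , All.map Add-flip ψ , Add-flip r₁ , Add-flip r₂ , Add-flip r₃)
  ... | inj₂ (σ , t₁ , m , m₁′ , T , t₁∈T , run , f₁ , σ→t₁ , ℓ≡ , ψ , r₁ , r₂ , r₃) =
    inj₂ (σ , t₁ , m , m₁′ , T , t₁∈T , run , f₁ , σ→t₁ , sym ℓ≡ , All.map Add-flip ψ ,
          Add-flip r₁ , Add-flip r₂ , Add-flip r₃)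

  IsBranchingPlaceBisim⇔ : ∀ R → IsBranchingPlaceBisim N R ⇔ (Simulation R × Simulation (flip R))
  IsBranchingPlaceBisim⇔ R = mk⇔
    (λ bisim → (λ m₁ m₂ rel → proj₁ (bisim m₁ m₂ rel)) ,
               (λ m₂ m₁ rel → Clause2⇒Clause1-flip (proj₂ (bisim m₁ m₂ (Add-flip rel)))))
    (λ (sim , simᶠ) m₁ m₂ rel → sim m₁ m₂ rel , Clause1-flip⇒Clause2 (simᶠ m₂ m₁ (Add-flip rel)))

  LocalSimulation : PlaceRel N → Set
  LocalSimulation R = ∀ t → t ∈ trans N → ∀ m₂ → Add N R (pre t) m₂ → CanMatch R t (pre t) m₂

  Simulation⇒LocalSimulation : ∀ {R} → Simulation R → LocalSimulation R
  Simulation⇒LocalSimulation sim t t∈T m₂ rel = sim (pre t) m₂ rel t _ t∈T (⊆-refl {a = pre t} , refl)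

  FireSeq-frame : ∀ {q m₂ σ m} → q ⊆ m₂ → FireSeq N q σ m → FireSeq N m₂ σ (m ⊕ (m₂ ⊖ q))
  FireSeq-frame {q} {m₂} {σ} {m} q⊆m₂ run =
    subst (λ z → FireSeq N z σ (m ⊕ (m₂ ⊖ q))) (⊕-⊖-inverse q⊆m₂) (FireSeq-⊕ (m₂ ⊖ q) run)

  FireSeq-exhausts : ∀ {R p q σ m} → FireSeq N q σ m → Add N R (p ⊖ p) (q ⊖ preS N σ) → q ≡ preS N σ
  FireSeq-exhausts {R} {p} run rel =
    ⊖≡θ⇒≡ (Add-θˡ (subst (λ z → Add N R z _) (⊖-self p) rel)) (FireSeq⇒preS⊆ run)

  CanMatch-extend : ∀ {R t q m₁ m₂} → CanMatch R t (pre t) q → q ⊆ m₂ →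
                    Add N R (m₁ ⊖ pre t) (m₂ ⊖ q) → CanMatch R t m₁ m₂
  CanMatch-extend {R} {t} {q} {m₁} {m₂}
                  (inj₁ (τt , σ , m₂′ , T , run , ψ , r₁ , r₂ , r₃)) q⊆m₂ rest =
    inj₁ (τt , σ , m₂′ ⊕ (m₂ ⊖ q) , T , FireSeq-frame q⊆m₂ run , ψ , r₁ , r₂ ,
          subst (λ z → Add N R (m₁ ⊖ pre t) (m₂ ⊖ z)) (FireSeq-exhausts run r₃) rest)
  CanMatch-extend {R} {t} {q} {m₁} {m₂}
                  (inj₂ (σ , t₂ , m , m₂′ , T , t₂∈T , run , f , σ→t₂ , ℓ≡ , ψ , r₁ , r₂ , r₃))
                  q⊆m₂ rest =
    inj₂ (σ , t₂ , m ⊕ (m₂ ⊖ q) , m₂′ ⊕ (m₂ ⊖ q) , T , t₂∈T , FireSeq-frame q⊆m₂ run ,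
          Fires-⊕ {m} {t₂} (m₂ ⊖ q) f , σ→t₂ , ℓ≡ , ψ , r₁ , r₂ ,
          subst (λ z → Add N R (m₁ ⊖ pre t) (m₂ ⊖ z)) (FireSeq-exhausts run r₃) rest)

  LocalSimulation⇒Simulation : ∀ {R} → LocalSimulation R → Simulation R
  LocalSimulation⇒Simulation local m₁ m₂ rel t m₁′ t∈T (en , _) =
    let q , q⊆m₂ , rel-pre , rel-rest = Add-split rel (pre t) en
    in CanMatch-extend (local t t∈T q rel-pre) q⊆m₂ rel-rest

  CanMatch? : ∀ R t m₁ m₂ → Dec (CanMatch R t m₁ m₂)
  CanMatch? R t m₁ m₂ =
    (TauSeqT? t ×-dec map′ (λ (σ , T , m₂′ , run , ψ , r) → σ , m₂′ , T , run , ψ , r)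
                           (λ (σ , m₂′ , T , run , ψ , r) → σ , T , m₂′ , run , ψ , r)
                           (TauRun? m₂ ∣ pre t ∣ bound (Add? R (pre t)) Silent?))
    ⊎-dec
    map′ (λ (σ , T , m , run , ψ , t₂ , t₂∈T , (m₂′ , f) , σ→t₂ , ℓ≡ , r) →
            σ , t₂ , m , m₂′ , T , t₂∈T , run , f , σ→t₂ , ℓ≡ , ψ , r)
         (λ (σ , t₂ , m , m₂′ , T , t₂∈T , run , f , σ→t₂ , ℓ≡ , ψ , r) →
            σ , T , m , run , ψ , t₂ , t₂∈T , (m₂′ , f) , σ→t₂ , ℓ≡ , r)
         (TauRun? m₂ ∣ pre t ∣ bound (Add? R (pre t)) Visible?)
    where
    bound : ∀ {x} → Add N R (pre t) x → ∣ x ∣ ≤ ∣ pre t ∣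
    bound rel = ≤-reflexive (sym (size-Add rel))
    Silent? : ∀ a b (_ : Mk) →
              Dec (Add N R (pre t) b × Add N R (post t) b × Add N R (m₁ ⊖ pre t) (m₂ ⊖ a))
    Silent? a b _ = Add? R _ _ ×-dec Add? R _ _ ×-dec Add? R _ _
    Visible? : ∀ a b m → Dec (Σ Tr λ t₂ → t₂ ∈ trans N × ∃ (Fires N m t₂) × b ≡ pre t₂ ×
                                lab t ≡ lab t₂ × Add N R (pre t) b × Add N R (post t) (post t₂) ×
                                Add N R (m₁ ⊖ pre t) (m₂ ⊖ a))
    Visible? a b m = ∃∈? (trans N) (λ t₂ → Fires? m t₂ ×-dec ≡-dec _≟ℕ_ b (pre t₂) ×-dec
                                           lab t ≟ lab t₂ ×-dec
                                           Add? R _ _ ×-dec Add? R _ _ ×-dec Add? R _ _)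

  LocalSimulation? : ∀ R → Dec (LocalSimulation R)
  LocalSimulation? R = map′ (λ all t t∈T → All.lookup all t∈T) (λ local → All.tabulate (local _))
    (All.all? (λ t → ∀?-among (map rhs (pairLists (pre t))) Add⇒∈map-rhs (Add? R (pre t))
                                (CanMatch? R t (pre t)))
              (trans N))

  IsBranchingPlaceBisim⇔Local : ∀ R →
    IsBranchingPlaceBisim N R ⇔ (LocalSimulation R × LocalSimulation (flip R))
  IsBranchingPlaceBisim⇔Local R = mk⇔
    (λ bisim → let sim , simᶠ = to bisim in Simulation⇒LocalSimulation sim , Simulation⇒LocalSimulation simᶠ)
    (λ (local , localᶠ) → from (LocalSimulation⇒Simulation local , LocalSimulation⇒Simulation localᶠ))
    where open Equivalence (IsBranchingPlaceBisim⇔ R)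

  module _ {R R′ : PlaceRel N} (R≗R′ : ∀ i j → R i j ≡ R′ i j) where

    CanMatch-resp : ∀ {t m₁ m₂} → CanMatch R t m₁ m₂ → CanMatch R′ t m₁ m₂
    CanMatch-resp (inj₁ (τt , σ , m₂′ , T , run , ψ , r₁ , r₂ , r₃)) =
      inj₁ (τt , σ , m₂′ , T , run , All.map (Add-resp R≗R′) ψ ,
            Add-resp R≗R′ r₁ , Add-resp R≗R′ r₂ , Add-resp R≗R′ r₃)
    CanMatch-resp (inj₂ (σ , t₂ , m , m₂′ , T , t₂∈T , run , f , σ→t₂ , ℓ≡ , ψ , r₁ , r₂ , r₃)) =
      inj₂ (σ , t₂ , m , m₂′ , T , t₂∈T , run , f , σ→t₂ , ℓ≡ , All.map (Add-resp R≗R′) ψ ,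
            Add-resp R≗R′ r₁ , Add-resp R≗R′ r₂ , Add-resp R≗R′ r₃)

    LocalSimulation-resp : LocalSimulation R → LocalSimulation R′
    LocalSimulation-resp local t t∈T m₂ rel =
      CanMatch-resp (local t t∈T m₂ (Add-resp (λ i j → sym (R≗R′ i j)) rel))

PlaceRel-searchable : (N : Net) → Searchable (PlaceRel N) (λ R R′ → ∀ i j → R i j ≡ R′ i j)
PlaceRel-searchable N = →-searchable (λ _ → refl) (→-searchable refl Bool-searchable (places N)) (places N)

theorem5p2 : (N : Net) (m₁ m₂ : Marking (places N)) →
    Dec (BranchingPlaceBisimilar N m₁ m₂)
theorem5p2 N m₁ m₂ =
  map′ (λ (R , local , rel) → R , from (IsBranchingPlaceBisim⇔Local N R) local , rel)
       (λ (R , bisim , rel) → R , to (IsBranchingPlaceBisim⇔Local N R) bisim , rel)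
       (PlaceRel-searchable N resp
          (λ R → (LocalSimulation? N R ×-dec LocalSimulation? N (flip R)) ×-dec Add? N R m₁ m₂))
  where
  open Equivalence
  resp : (λ R → (LocalSimulation N R × LocalSimulation N (flip R)) × Add N R m₁ m₂)
           Respects (λ R R′ → ∀ i j → R i j ≡ R′ i j)
  resp R≗R′ ((local , localᶠ) , rel) =
    (LocalSimulation-resp N R≗R′ local , LocalSimulation-resp N (λ i j → R≗R′ j i) localᶠ) ,
    Add-resp N R≗R′ rel
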